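{- Let $k>2$ be a prime such that $2^k-1$ is prime. Let $n = 2^{\alpha-1}p^{\beta-1}$, where $\alpha,\beta>1$ are integers and $p$ is an odd prime with $p<3\cdot 2^{\alpha-1}-1$ and $p\equiv 1\pmod 4$. Suppose $n$ divides $\sigma_k(n)$. Write $\beta = 2^v\beta_1$, where $v\ge 1$ and $\beta_1$ is odd. Then $$p^{2^v-1}\ \le\ \frac{2^{k(v+1)}-1}{2^k-1}.$$
   Context: For a positive integer $n$ and integer $k\ge 1$, $\sigma_k(n)=\sum_{d\mid n} d^k$, the sum over positive divisors $d$ of $n$. -}

module Defs where

open import Data.Nat using (ℕ; suc; _^_)
open import Data.Nat.Divisibility using (_∣?_)
open import Data.List using (List; filter; map; applyUpTo)
open import Data.Nat.ListAction using (sum)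

divisors : ℕ → List ℕ
divisors n = filter (λ d → d ∣? n) (applyUpTo suc n)

σ : ℕ → ℕ → ℕ
σ k n = sum (map (λ d → d ^ k) (divisors n))

module Submission where

-- Let n = 2^a p^b with a = α - 1, b = β - 1, p an odd prime with p ≡ 1 (mod 4).
-- Writing geo r m = 1 + r + ⋯ + r^(m-1), the divisors of n are exactly the
-- products 2^i p^j (i ≤ a, j ≤ b), each listed once, so
--     σ_k(n) = S · T,   S = geo (2^k) (a+1),   T = geo (p^k) (b+1).
-- S is odd and T ≡ 1 (mod p), so n ∣ S·T splits into 2^a ∣ T and p^b ∣ S.
-- Since p^k ≡ 1 (mod 4) and b + 1 = 2^v β₁ with β₁ odd, halving the length of
-- the geometric sum v times shows T = 2^v · (odd), whence a ≤ v.  Therefore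
--     p^(2^v - 1) ≤ p^b ≤ S ≤ geo (2^k) (v+1) = (2^(k(v+1)) - 1) / (2^k - 1).

open import Defs
open import Data.Nat using (ℕ; zero; suc; _+_; _*_; _∸_; _^_; _<_; _≤_; _%_; _/_;
  z≤n; s≤s; s≤s⁻¹; NonZero; ≢-nonZero⁻¹; nonTrivial⇒n>1)
open import Data.Nat.Properties
open import Data.Nat.DivMod using (m≡m%n+[m/n]*n; m%n<n)
open import Data.Nat.Divisibility using (_∣_; _∣?_; divides; ∣-trans; m∣m*n; n∣m*n; *-pres-∣;
  ∣⇒≤; ∣m+n∣m⇒∣n; ∣1⇒≡1; *-cancelˡ-∣; 0∣⇒≡0)
open import Data.Nat.Primality using (Prime; prime[2]; ¬prime[1]; prime⇒nonZero; prime⇒nonTrivial;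
  prime⇒irreducible)
open import Data.Nat.Coprimality using (Coprime; coprime-divisor)
open import Data.Nat.ListAction using (sum)
open import Data.Nat.ListAction.Properties using (sum-++; sum-↭)
open import Data.Nat.Tactic.RingSolver using (solve-∀)
open import Data.List using (List; []; _∷_; _++_; map; applyUpTo; upTo; cartesianProductWith)
open import Data.List.Properties using (map-++; map-applyUpTo; map-∘)
open import Data.List.Membership.Propositional using (_∈_)
open import Data.List.Membership.Propositional.Properties using (∈-filter⁺; ∈-filter⁻; ∈-applyUpTo⁺;
  ∈-cartesianProductWith⁺; ∈-cartesianProductWith⁻; ∈-upTo⁺; ∈-upTo⁻)
open import Data.List.Membership.Propositional.Properties.WithK using (unique∧set⇒bag)
open import Data.List.Relation.Unary.Unique.Propositional using (Unique)
open import Data.List.Relation.Unary.Unique.Propositional.Properties using (filter⁺; applyUpTo⁺₁;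
  upTo⁺; cartesianProductWith⁺)
open import Data.List.Relation.Binary.BagAndSetEquality using (∼bag⇒↭)
open import Data.List.Relation.Binary.Permutation.Propositional.Properties using (map⁺)
open import Data.Product using (_×_; _,_; ∃-syntax; ∃₂; proj₁; proj₂)
open import Data.Sum using (_⊎_; inj₁; inj₂)
open import Function using (_∘_; _⇔_; mk⇔; Equivalence)
open import Relation.Nullary using (¬_; yes; no; contradiction)
open import Relation.Binary.Definitions using (tri<; tri≈; tri>)
open import Relation.Binary.PropositionalEquality using (_≡_; _≢_; refl; sym; trans; cong; cong₂; subst; subst₂;
  module ≡-Reasoning)

-- Odd numbers and numbers ≡ 1 (mod 4), with explicit witnesses so that the
-- ring solver can manipulate them.
Odd : ℕ → Set
Odd n = ∃[ t ] n ≡ 1 + 2 * t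

OneMod4 : ℕ → Set
OneMod4 n = ∃[ t ] n ≡ 1 + 4 * t

odd⇒¬2∣ : ∀ {n} → Odd n → ¬ (2 ∣ n)
odd⇒¬2∣ (t , refl) 2∣n with ∣1⇒≡1 (∣m+n∣m⇒∣n (subst (2 ∣_) (+-comm 1 (2 * t)) 2∣n) (m∣m*n t))
... | ()

¬2∣⇒odd : ∀ {n} → ¬ (2 ∣ n) → Odd n
¬2∣⇒odd {n} 2∤n with n % 2 | m≡m%n+[m/n]*n n 2 | m%n<n n 2
... | 0           | n≡[n/2]*2 | _ = contradiction (divides (n / 2) n≡[n/2]*2) 2∤n
... | 1           | n≡1+[n/2]*2 | _ = n / 2 , trans n≡1+[n/2]*2 (cong suc (*-comm (n / 2) 2))
... | suc (suc _) | _ | s≤s (s≤s ())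

odd⇒nonZero : ∀ {n} → Odd n → NonZero n
odd⇒nonZero (t , refl) = _

odd-* : ∀ {m n} → Odd m → Odd n → Odd (m * n)
odd-* (s , refl) (t , refl) = s + t + 2 * s * t , lemma s t
  where
  lemma : ∀ s t → (1 + 2 * s) * (1 + 2 * t) ≡ 1 + 2 * (s + t + 2 * s * t)
  lemma = solve-∀

odd-^ : ∀ {m} n → Odd m → Odd (m ^ n)
odd-^ zero    _     = 0 , refl
odd-^ (suc n) odd-m = odd-* odd-m (odd-^ n odd-m)

oneMod4-* : ∀ {m n} → OneMod4 m → OneMod4 n → OneMod4 (m * n)
oneMod4-* (s , refl) (t , refl) = s + t + 4 * s * t , lemma s t
  where
  lemma : ∀ s t → (1 + 4 * s) * (1 + 4 * t) ≡ 1 + 4 * (s + t + 4 * s * t)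
  lemma = solve-∀

oneMod4-^ : ∀ {m} n → OneMod4 m → OneMod4 (m ^ n)
oneMod4-^ zero    _   = 0 , refl
oneMod4-^ (suc n) m≡1 = oneMod4-* m≡1 (oneMod4-^ n m≡1)

oneMod4⇒odd : ∀ {n} → OneMod4 n → Odd n
oneMod4⇒odd (t , refl) = 2 * t , lemma t
  where
  lemma : ∀ t → 1 + 4 * t ≡ 1 + 2 * (2 * t)
  lemma = solve-∀

%4≡1⇒oneMod4 : ∀ n → n % 4 ≡ 1 → OneMod4 n
%4≡1⇒oneMod4 n n%4≡1 = n / 4 , trans (m≡m%n+[m/n]*n n 4) (cong₂ _+_ n%4≡1 (*-comm (n / 4) 4))

geo : ℕ → ℕ → ℕ
geo r zero    = 0
geo r (suc m) = 1 + r * geo r m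

geo-telescope : ∀ s m → geo (suc s) m * s + 1 ≡ suc s ^ m
geo-telescope s zero    = refl
geo-telescope s (suc m) = begin
  (1 + suc s * geo (suc s) m) * s + 1 ≡⟨ lemma s (geo (suc s) m) ⟩
  suc s * (geo (suc s) m * s + 1)     ≡⟨ cong (suc s *_) (geo-telescope s m) ⟩
  suc s * suc s ^ m                   ∎
  where
  open ≡-Reasoning
  lemma : ∀ s g → (1 + (1 + s) * g) * s + 1 ≡ (1 + s) * (g * s + 1)
  lemma = solve-∀

geo-closed : ∀ r m → .{{NonZero r}} → geo r m * (r ∸ 1) ≡ r ^ m ∸ 1
geo-closed (suc s) m = begin
  geo (suc s) m * s         ≡⟨ m+n∸n≡m _ 1 ⟨
  geo (suc s) m * s + 1 ∸ 1 ≡⟨ cong (_∸ 1) (geo-telescope s m) ⟩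
  suc s ^ m ∸ 1             ∎
  where open ≡-Reasoning

geo-mono : ∀ r {m n} → m ≤ n → geo r m ≤ geo r n
geo-mono r z≤n       = z≤n
geo-mono r (s≤s m≤n) = s≤s (*-monoʳ-≤ r (geo-mono r m≤n))

-- A non-empty geometric sum is ≡ 1 modulo the ratio, hence not divisible by
-- any prime dividing the ratio.
prime∤geo : ∀ {q r} m → Prime q → q ∣ r → ¬ (q ∣ geo r (suc m))
prime∤geo {q} {r} m q-prime q∣r q∣geo =
  ¬prime[1] (subst Prime (∣1⇒≡1 q∣1) q-prime)
  where
  q∣1 : q ∣ 1
  q∣1 = ∣m+n∣m⇒∣n (subst (q ∣_) (+-comm 1 (r * geo r m)) q∣geo) (∣-trans q∣r (m∣m*n (geo r m)))

geo-odd : ∀ {r} m → 2 ∣ r → Odd (geo r (suc m))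
geo-odd {r} m (divides c refl) = c * geo r m , cong suc (lemma c (geo r m))
  where
  lemma : ∀ c g → c * 2 * g ≡ 2 * (c * g)
  lemma = solve-∀

-- With odd ratio, geo q m ≡ m (mod 2): every term is odd.
geo-parity : ∀ {q} m → Odd q → ∃[ e ] geo q m ≡ m + 2 * e
geo-parity zero    _                = 0 , refl
geo-parity {q} (suc m) odd-q@(t , refl) with geo-parity m odd-q
... | e , geo≡ = e + t * m + 2 * t * e , trans (cong (λ g → 1 + q * g) geo≡) (lemma t m e)
  where
  lemma : ∀ t m e → 1 + (1 + 2 * t) * (m + 2 * e) ≡ suc m + 2 * (e + t * m + 2 * t * e)
  lemma = solve-∀

-- Pairing consecutive terms: 1 + q + ⋯ + q^(2m-1) = (1 + q)(1 + q² + ⋯ + q^(2m-2)).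
geo-double : ∀ q m → geo q (m + m) ≡ (1 + q) * geo (q * q) m
geo-double q zero    = sym (*-zeroʳ (1 + q))
geo-double q (suc m) = begin
  geo q (suc m + suc m)                   ≡⟨ cong (geo q ∘ suc) (+-suc m m) ⟩
  1 + q * (1 + q * geo q (m + m))         ≡⟨ cong (λ g → 1 + q * (1 + q * g)) (geo-double q m) ⟩
  1 + q * (1 + q * ((1 + q) * geo (q * q) m)) ≡⟨ lemma q (geo (q * q) m) ⟩
  (1 + q) * (1 + q * q * geo (q * q) m)   ∎
  where
  open ≡-Reasoning
  lemma : ∀ q h → 1 + q * (1 + q * ((1 + q) * h)) ≡ (1 + q) * (1 + q * q * h)
  lemma = solve-∀

geo-twoAdic : ∀ v {β₁ q} → OneMod4 q → Odd β₁ → ∃[ o ] Odd o × geo q (2 ^ v * β₁) ≡ 2 ^ v * o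
geo-twoAdic zero {β₁} {q} q≡1 (s , refl) with geo-parity β₁ (oneMod4⇒odd q≡1)
... | e , geo≡ = 1 + 2 * (s + e) , (s + e , refl) , (begin
  geo q (1 * β₁)   ≡⟨ cong (geo q) (*-identityˡ β₁) ⟩
  geo q β₁         ≡⟨ geo≡ ⟩
  β₁ + 2 * e       ≡⟨ lemma s e ⟩
  1 * (1 + 2 * (s + e)) ∎)
  where
  open ≡-Reasoning
  lemma : ∀ s e → 1 + 2 * s + 2 * e ≡ 1 * (1 + 2 * (s + e))
  lemma = solve-∀
geo-twoAdic (suc v) {β₁} {q} q≡1@(t , refl) odd-β₁
  with geo-twoAdic v (oneMod4-* q≡1 q≡1) odd-β₁
... | o , odd-o , geo≡ = (1 + 2 * t) * o , odd-* (t , refl) odd-o , (begin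
  geo q (2 * 2 ^ v * β₁)                ≡⟨ cong (geo q) (lemma₁ (2 ^ v) β₁) ⟩
  geo q (2 ^ v * β₁ + 2 ^ v * β₁)       ≡⟨ geo-double q (2 ^ v * β₁) ⟩
  (1 + q) * geo (q * q) (2 ^ v * β₁)    ≡⟨ cong ((1 + q) *_) geo≡ ⟩
  (1 + q) * (2 ^ v * o)                 ≡⟨ lemma₂ t (2 ^ v) o ⟩
  2 * 2 ^ v * ((1 + 2 * t) * o)         ∎)
  where
  open ≡-Reasoning
  lemma₁ : ∀ x b → 2 * x * b ≡ x * b + x * b
  lemma₁ = solve-∀
  lemma₂ : ∀ t x o → (1 + (1 + 4 * t)) * (x * o) ≡ 2 * x * ((1 + 2 * t) * o)
  lemma₂ = solve-∀

^-monoʳ-∣ : ∀ q {i a} → i ≤ a → q ^ i ∣ q ^ a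
^-monoʳ-∣ q {i} {a} i≤a = divides (q ^ (a ∸ i)) (begin
  q ^ a               ≡⟨ cong (q ^_) (m+[n∸m]≡n i≤a) ⟨
  q ^ (i + (a ∸ i))   ≡⟨ ^-distribˡ-+-* q i (a ∸ i) ⟩
  q ^ i * q ^ (a ∸ i) ≡⟨ *-comm (q ^ i) _ ⟩
  q ^ (a ∸ i) * q ^ i ∎)
  where open ≡-Reasoning

^-injectiveʳ : ∀ {p} → 1 < p → ∀ {i j} → p ^ i ≡ p ^ j → i ≡ j
^-injectiveʳ {p} 1<p {i} {j} pⁱ≡pʲ with <-cmp i j
... | tri< i<j _ _ = contradiction pⁱ≡pʲ (<⇒≢ (^-monoʳ-< p 1<p i<j))
... | tri≈ _ i≡j _ = i≡j
... | tri> _ _ j<i = contradiction (sym pⁱ≡pʲ) (<⇒≢ (^-monoʳ-< p 1<p j<i))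

^-distribʳ-* : ∀ m n k → (m * n) ^ k ≡ m ^ k * n ^ k
^-distribʳ-* m n zero    = refl
^-distribʳ-* m n (suc k) = begin
  m * n * (m * n) ^ k     ≡⟨ cong (m * n *_) (^-distribʳ-* m n k) ⟩
  m * n * (m ^ k * n ^ k) ≡⟨ lemma m n (m ^ k) (n ^ k) ⟩
  m * m ^ k * (n * n ^ k) ∎
  where
  open ≡-Reasoning
  lemma : ∀ m n x y → m * n * (x * y) ≡ m * x * (n * y)
  lemma = solve-∀

prime∤⇒coprime : ∀ {q d} → Prime q → ¬ (q ∣ d) → Coprime d q
prime∤⇒coprime q-prime q∤d (e∣d , e∣q) with prime⇒irreducible q-prime e∣q
... | inj₁ e≡1 = e≡1
... | inj₂ refl = contradiction e∣d q∤d

∣prime*⇒ : ∀ {q d m} → Prime q → d ∣ q * m → (∃[ c ] d ≡ q * c × c ∣ m) ⊎ d ∣ m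
∣prime*⇒ {q} {d} {m} q-prime d∣qm with q ∣? d
... | no q∤d = inj₂ (coprime-divisor (prime∤⇒coprime q-prime q∤d) d∣qm)
... | yes (divides c refl) =
  inj₁ (c , *-comm c q , *-cancelˡ-∣ q {{prime⇒nonZero q-prime}} (subst (_∣ q * m) (*-comm c q) d∣qm))

∣prime^⇒ : ∀ {q d} b → Prime q → d ∣ q ^ b → ∃[ j ] j ≤ b × d ≡ q ^ j
∣prime^⇒ zero q-prime d∣1 = 0 , z≤n , ∣1⇒≡1 d∣1
∣prime^⇒ {q} (suc b) q-prime d∣qqᵇ with ∣prime*⇒ q-prime d∣qqᵇ
... | inj₂ d∣qᵇ with ∣prime^⇒ b q-prime d∣qᵇ
...   | j , j≤b , d≡qʲ = j , m≤n⇒m≤1+n j≤b , d≡qʲ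
∣prime^⇒ {q} (suc b) q-prime _ | inj₁ (c , refl , c∣qᵇ) with ∣prime^⇒ b q-prime c∣qᵇ
...   | j , j≤b , c≡qʲ = suc j , s≤s j≤b , cong (q *_) c≡qʲ

∣prime^*prime^⇒ : ∀ {q p d} a b → Prime q → Prime p → d ∣ q ^ a * p ^ b →
                  ∃₂ λ i j → i ≤ a × j ≤ b × d ≡ q ^ i * p ^ j
∣prime^*prime^⇒ {q} {p} {d} zero b q-prime p-prime d∣pᵇ
  with ∣prime^⇒ b p-prime (subst (d ∣_) (*-identityˡ (p ^ b)) d∣pᵇ)
... | j , j≤b , d≡pʲ = 0 , j , z≤n , j≤b , trans d≡pʲ (sym (*-identityˡ _))
∣prime^*prime^⇒ {q} {p} {d} (suc a) b q-prime p-prime d∣n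
  with ∣prime*⇒ q-prime (subst (d ∣_) (*-assoc q (q ^ a) (p ^ b)) d∣n)
... | inj₂ d∣n′ with ∣prime^*prime^⇒ a b q-prime p-prime d∣n′
...   | i , j , i≤a , j≤b , d≡ = i , j , m≤n⇒m≤1+n i≤a , j≤b , d≡
∣prime^*prime^⇒ {q} {p} (suc a) b q-prime p-prime _ | inj₁ (c , refl , c∣n′)
  with ∣prime^*prime^⇒ a b q-prime p-prime c∣n′
...   | i , j , i≤a , j≤b , c≡ =
  suc i , j , s≤s i≤a , j≤b , trans (cong (q *_) c≡) (sym (*-assoc q (q ^ i) (p ^ j)))

prime^-coprime : ∀ {q x} b → Prime q → ¬ (q ∣ x) → Coprime (q ^ b) x
prime^-coprime {q} b q-prime q∤x (e∣qᵇ , e∣x) with ∣prime^⇒ b q-prime e∣qᵇ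
... | zero  , _ , e≡1    = e≡1
... | suc j , _ , refl = contradiction (∣-trans (m∣m*n (q ^ j)) e∣x) q∤x

prime^∣*⇒∣ʳ : ∀ {q x y} b → Prime q → ¬ (q ∣ x) → q ^ b ∣ x * y → q ^ b ∣ y
prime^∣*⇒∣ʳ b q-prime q∤x = coprime-divisor (prime^-coprime b q-prime q∤x)

divisors-unique : ∀ n → Unique (divisors n)
divisors-unique n =
  filter⁺ (_∣? n) (applyUpTo⁺₁ suc n (λ i<j _ 1+i≡1+j → <⇒≢ i<j (suc-injective 1+i≡1+j)))

∈divisors⇔∣ : ∀ {n d} → .{{NonZero n}} → d ∈ divisors n ⇔ d ∣ n
∈divisors⇔∣ {n} = mk⇔ (proj₂ ∘ ∈-filter⁻ (_∣? n) {xs = applyUpTo suc n}) ∣⇒∈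
  where
  ∣⇒∈ : ∀ {d} → d ∣ n → d ∈ divisors n
  ∣⇒∈ {zero}  d∣n = contradiction (0∣⇒≡0 d∣n) (≢-nonZero⁻¹ n)
  ∣⇒∈ {suc e} d∣n = ∈-filter⁺ (_∣? n) (∈-applyUpTo⁺ suc (∣⇒≤ d∣n)) d∣n

-- σ_k(n) is the sum of d^k over ANY duplicate-free list of the divisors of n,
-- since such a list is a permutation of `divisors n`.
σ-enumeration : ∀ k {n} ds → .{{NonZero n}} → Unique ds → (∀ {d} → d ∈ ds ⇔ d ∣ n) →
                σ k n ≡ sum (map (_^ k) ds)
σ-enumeration k {n} ds ds-unique ds-complete =
  sum-↭ (map⁺ (_^ k) (∼bag⇒↭ (unique∧set⇒bag (divisors-unique n) ds-unique same-elements)))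
  where
  same-elements : ∀ {d} → d ∈ divisors n ⇔ d ∈ ds
  same-elements = mk⇔ (Equivalence.from ds-complete ∘ Equivalence.to ∈divisors⇔∣)
                      (Equivalence.from ∈divisors⇔∣ ∘ Equivalence.to ds-complete)

sum-scale : ∀ (h w : ℕ → ℕ) c → (∀ j → h j ≡ c * w j) → ∀ ys → sum (map h ys) ≡ c * sum (map w ys)
sum-scale h w c h≡cw []       = sym (*-zeroʳ c)
sum-scale h w c h≡cw (y ∷ ys) =
  trans (cong₂ _+_ (h≡cw y) (sum-scale h w c h≡cw ys)) (sym (*-distribˡ-+ c (w y) _))

sum-grid : ∀ (h : ℕ → ℕ) (g : ℕ → ℕ → ℕ) (u w : ℕ → ℕ) → (∀ i j → h (g i j) ≡ u i * w j) →
           ∀ xs ys → sum (map h (cartesianProductWith g xs ys)) ≡ sum (map u xs) * sum (map w ys)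
sum-grid h g u w h∘g≡uw []       ys = refl
sum-grid h g u w h∘g≡uw (x ∷ xs) ys = begin
  sum (map h (map (g x) ys ++ cartesianProductWith g xs ys))
    ≡⟨ cong sum (map-++ h (map (g x) ys) _) ⟩
  sum (map h (map (g x) ys) ++ map h (cartesianProductWith g xs ys))
    ≡⟨ sum-++ (map h (map (g x) ys)) _ ⟩
  sum (map h (map (g x) ys)) + sum (map h (cartesianProductWith g xs ys))
    ≡⟨ cong₂ _+_ row (sum-grid h g u w h∘g≡uw xs ys) ⟩
  u x * sum (map w ys) + sum (map u xs) * sum (map w ys)
    ≡⟨ *-distribʳ-+ (sum (map w ys)) (u x) _ ⟨
  (u x + sum (map u xs)) * sum (map w ys) ∎
  where
  open ≡-Reasoning
  row : sum (map h (map (g x) ys)) ≡ u x * sum (map w ys)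
  row = trans (cong sum (sym (map-∘ ys))) (sum-scale (h ∘ g x) w (u x) (h∘g≡uw x) ys)

sum-geometric : ∀ (f : ℕ → ℕ) c r n → (∀ i → f i ≡ c * r ^ i) → sum (applyUpTo f n) ≡ c * geo r n
sum-geometric f c r zero    _      = sym (*-zeroʳ c)
sum-geometric f c r (suc n) f≡crⁱ = begin
  f 0 + sum (applyUpTo (f ∘ suc) n) ≡⟨ cong₂ _+_ (f≡crⁱ 0) (sum-geometric (f ∘ suc) (c * r) r n f∘suc≡) ⟩
  c * 1 + c * r * geo r n          ≡⟨ lemma c r (geo r n) ⟩
  c * (1 + r * geo r n)            ∎
  where
  open ≡-Reasoning
  f∘suc≡ : ∀ i → f (suc i) ≡ c * r * r ^ i
  f∘suc≡ i = trans (f≡crⁱ (suc i)) (sym (*-assoc c r (r ^ i)))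
  lemma : ∀ c r g → c * 1 + c * r * g ≡ c * (1 + r * g)
  lemma = solve-∀

sum-powers : ∀ r n → sum (map (r ^_) (upTo n)) ≡ geo r n
sum-powers r n = begin
  sum (map (r ^_) (upTo n))    ≡⟨ cong sum (map-applyUpTo (λ i → i) (r ^_) n) ⟩
  sum (applyUpTo (r ^_) n)     ≡⟨ sum-geometric (r ^_) 1 r n (λ i → sym (*-identityˡ (r ^ i))) ⟩
  1 * geo r n                  ≡⟨ *-identityˡ (geo r n) ⟩
  geo r n                      ∎
  where open ≡-Reasoning

module TwoPrimePowers {p} (p-prime : Prime p) (p-odd : Odd p) where

  1<p : 1 < p
  1<p = nonTrivial⇒n>1 p {{prime⇒nonTrivial p-prime}}

  pʲ≢2* : ∀ j n → p ^ j ≢ 2 * n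
  pʲ≢2* j n pʲ≡2n = odd⇒¬2∣ (odd-^ j p-odd) (divides n (trans pʲ≡2n (*-comm 2 n)))

  2ⁱpʲ-injective : ∀ {i i′ j j′} → 2 ^ i * p ^ j ≡ 2 ^ i′ * p ^ j′ → i ≡ i′ × j ≡ j′
  2ⁱpʲ-injective {zero} {zero} {j} {j′} eq =
    refl , ^-injectiveʳ 1<p (trans (sym (*-identityˡ (p ^ j))) (trans eq (*-identityˡ (p ^ j′))))
  2ⁱpʲ-injective {suc i} {suc i′} {j} {j′} eq
    with 2ⁱpʲ-injective {i} {i′} (*-cancelˡ-≡ (2 ^ i * p ^ j) (2 ^ i′ * p ^ j′) 2 (trans (sym (*-assoc 2 (2 ^ i) (p ^ j)))
                                                     (trans eq (*-assoc 2 (2 ^ i′) (p ^ j′)))))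
  ... | refl , j≡j′ = refl , j≡j′
  2ⁱpʲ-injective {zero} {suc i′} {j} {j′} eq =
    contradiction (trans (sym (*-identityˡ (p ^ j))) (trans eq (*-assoc 2 (2 ^ i′) (p ^ j′)))) (pʲ≢2* j (2 ^ i′ * p ^ j′))
  2ⁱpʲ-injective {suc i} {zero} {j} {j′} eq =
    contradiction (trans (sym (*-identityˡ (p ^ j′))) (trans (sym eq) (*-assoc 2 (2 ^ i) (p ^ j)))) (pʲ≢2* j′ (2 ^ i * p ^ j))

  2ⁱpʲ : ℕ → ℕ → ℕ
  2ⁱpʲ i j = 2 ^ i * p ^ j

  grid : ℕ → ℕ → List ℕ
  grid a b = cartesianProductWith 2ⁱpʲ (upTo (suc a)) (upTo (suc b))

  grid-unique : ∀ a b → Unique (grid a b)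
  grid-unique a b = cartesianProductWith⁺ 2ⁱpʲ 2ⁱpʲ-injective (upTo⁺ (suc a)) (upTo⁺ (suc b))

  grid-complete : ∀ a b {d} → d ∈ grid a b ⇔ d ∣ 2ⁱpʲ a b
  grid-complete a b = mk⇔ ∈⇒∣ ∣⇒∈
    where
    ∈⇒∣ : ∀ {d} → d ∈ grid a b → d ∣ 2ⁱpʲ a b
    ∈⇒∣ d∈ with ∈-cartesianProductWith⁻ 2ⁱpʲ (upTo (suc a)) (upTo (suc b)) d∈
    ... | i , j , i∈ , j∈ , refl =
      *-pres-∣ (^-monoʳ-∣ 2 (s≤s⁻¹ (∈-upTo⁻ i∈))) (^-monoʳ-∣ p (s≤s⁻¹ (∈-upTo⁻ j∈)))
    ∣⇒∈ : ∀ {d} → d ∣ 2ⁱpʲ a b → d ∈ grid a b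
    ∣⇒∈ d∣ with ∣prime^*prime^⇒ a b prime[2] p-prime d∣
    ... | i , j , i≤a , j≤b , refl = ∈-cartesianProductWith⁺ 2ⁱpʲ (∈-upTo⁺ (s≤s i≤a)) (∈-upTo⁺ (s≤s j≤b))

  σ-2ᵃpᵇ : ∀ k a b → σ k (2 ^ a * p ^ b) ≡ geo (2 ^ k) (suc a) * geo (p ^ k) (suc b)
  σ-2ᵃpᵇ k a b = begin
    σ k (2ⁱpʲ a b)
      ≡⟨ σ-enumeration k (grid a b) {{2ⁱpʲ≢0}} (grid-unique a b) (grid-complete a b) ⟩
    sum (map (_^ k) (grid a b))
      ≡⟨ sum-grid (_^ k) 2ⁱpʲ ((2 ^ k) ^_) ((p ^ k) ^_) 2ⁱpʲ^k (upTo (suc a)) (upTo (suc b)) ⟩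
    sum (map ((2 ^ k) ^_) (upTo (suc a))) * sum (map ((p ^ k) ^_) (upTo (suc b)))
      ≡⟨ cong₂ _*_ (sum-powers (2 ^ k) (suc a)) (sum-powers (p ^ k) (suc b)) ⟩
    geo (2 ^ k) (suc a) * geo (p ^ k) (suc b) ∎
    where
    open ≡-Reasoning
    instance
      p≢0 : NonZero p
      p≢0 = prime⇒nonZero p-prime
    2ⁱpʲ≢0 : NonZero (2ⁱpʲ a b)
    2ⁱpʲ≢0 = m*n≢0 (2 ^ a) (p ^ b) {{m^n≢0 2 a}} {{m^n≢0 p b}}
    ^-comm : ∀ q i → (q ^ i) ^ k ≡ (q ^ k) ^ i
    ^-comm q i = trans (^-*-assoc q i k) (trans (cong (q ^_) (*-comm i k)) (sym (^-*-assoc q k i)))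
    2ⁱpʲ^k : ∀ i j → 2ⁱpʲ i j ^ k ≡ (2 ^ k) ^ i * (p ^ k) ^ j
    2ⁱpʲ^k i j = trans (^-distribʳ-* (2 ^ i) (p ^ j) k) (cong₂ _*_ (^-comm 2 i) (^-comm p j))

-- If 2^a p^b ∣ σ_k(2^a) σ_k(p^b) with k ≥ 1 and p prime, then 2^a ∣ σ_k(p^b) and
-- p^b ∣ σ_k(2^a): the factor σ_k(2^a) is odd and σ_k(p^b) is ≡ 1 (mod p).
split-divisibility : ∀ {p} k′ a b → Prime p →
  2 ^ a * p ^ b ∣ geo (2 ^ suc k′) (suc a) * geo (p ^ suc k′) (suc b) →
  2 ^ a ∣ geo (p ^ suc k′) (suc b) × p ^ b ∣ geo (2 ^ suc k′) (suc a)
split-divisibility {p} k′ a b p-prime n∣ST = 2ᵃ∣T , pᵇ∣S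
  where
  S T : ℕ
  S = geo (2 ^ suc k′) (suc a)
  T = geo (p ^ suc k′) (suc b)
  2∤S : ¬ (2 ∣ S)
  2∤S = odd⇒¬2∣ (geo-odd a (divides (2 ^ k′) (*-comm 2 (2 ^ k′))))
  p∤T : ¬ (p ∣ T)
  p∤T = prime∤geo b p-prime (divides (p ^ k′) (*-comm p (p ^ k′)))
  2ᵃ∣T : 2 ^ a ∣ T
  2ᵃ∣T = prime^∣*⇒∣ʳ a prime[2] 2∤S (∣-trans (m∣m*n (p ^ b)) n∣ST)
  pᵇ∣S : p ^ b ∣ S
  pᵇ∣S = prime^∣*⇒∣ʳ b p-prime p∤T (subst (p ^ b ∣_) (*-comm S T) (∣-trans (n∣m*n (2 ^ a)) n∣ST))

-- If 2^a divides a geometric sum with ratio ≡ 1 (mod 4) and length 2^v β₁,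
-- β₁ odd, then a ≤ v: the sum is 2^v times an odd number.
twoAdic-bound : ∀ {q β₁} a v → OneMod4 q → Odd β₁ → 2 ^ a ∣ geo q (2 ^ v * β₁) → a ≤ v
twoAdic-bound a v q≡1 odd-β₁ 2ᵃ∣geo with geo-twoAdic v q≡1 odd-β₁ | a ≤? v
... | _           | yes a≤v = a≤v
... | o , odd-o , geo≡2ᵛo | no a≰v = contradiction 2∣o (odd⇒¬2∣ odd-o)
  where
  2ᵛ⁺¹∣2ᵛo : 2 ^ v * 2 ∣ 2 ^ v * o
  2ᵛ⁺¹∣2ᵛo = subst₂ _∣_ (*-comm 2 (2 ^ v)) geo≡2ᵛo (∣-trans (^-monoʳ-∣ 2 (≰⇒> a≰v)) 2ᵃ∣geo)
  2∣o : 2 ∣ o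
  2∣o = *-cancelˡ-∣ (2 ^ v) {{m^n≢0 2 v}} 2ᵛ⁺¹∣2ᵛo

lemma4p2 : (k α β p v β₁ : ℕ) →
    Prime k → 2 < k → Prime (2 ^ k ∸ 1) →
    1 < α → 1 < β →
    Prime p → ¬ (2 ∣ p) → p < 3 * 2 ^ (α ∸ 1) ∸ 1 → p % 4 ≡ 1 →
    (2 ^ (α ∸ 1) * p ^ (β ∸ 1)) ∣ σ k (2 ^ (α ∸ 1) * p ^ (β ∸ 1)) →
    β ≡ 2 ^ v * β₁ → 1 ≤ v → ¬ (2 ∣ β₁) →
    p ^ (2 ^ v ∸ 1) * (2 ^ k ∸ 1) ≤ 2 ^ (k * (v + 1)) ∸ 1
lemma4p2 zero _ _ _ _ _ _ () _ _ _ _ _ _ _ _ _ _ _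
lemma4p2 k@(suc k′) α (suc b) p v β₁ _ _ _ _ _ p-prime 2∤p _ p%4≡1 n∣σn β≡2ᵛβ₁ _ 2∤β₁ = begin
  p ^ (2 ^ v ∸ 1) * (2 ^ k ∸ 1)     ≤⟨ *-monoˡ-≤ (2 ^ k ∸ 1) p^[2ᵛ∸1]≤σ₂ᵛ ⟩
  geo (2 ^ k) (suc v) * (2 ^ k ∸ 1) ≡⟨ geo-closed (2 ^ k) (suc v) {{m^n≢0 2 k}} ⟩
  (2 ^ k) ^ suc v ∸ 1               ≡⟨ cong (_∸ 1) (^-*-assoc 2 k (suc v)) ⟩
  2 ^ (k * suc v) ∸ 1               ≡⟨ cong (λ x → 2 ^ (k * x) ∸ 1) (+-comm 1 v) ⟩
  2 ^ (k * (v + 1)) ∸ 1             ∎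
  where
  open ≤-Reasoning
  open TwoPrimePowers p-prime (¬2∣⇒odd 2∤p)
  instance
    p≢0 : NonZero p
    p≢0 = prime⇒nonZero p-prime
  a : ℕ
  a = α ∸ 1
  parts : 2 ^ a ∣ geo (p ^ k) (suc b) × p ^ b ∣ geo (2 ^ k) (suc a)
  parts = split-divisibility k′ a b p-prime (subst (2 ^ a * p ^ b ∣_) (σ-2ᵃpᵇ k a b) n∣σn)
  a≤v : a ≤ v
  a≤v = twoAdic-bound a v (oneMod4-^ k (%4≡1⇒oneMod4 p p%4≡1)) (¬2∣⇒odd 2∤β₁)
                      (subst (λ m → 2 ^ a ∣ geo (p ^ k) m) β≡2ᵛβ₁ (proj₁ parts))
  2ᵛ∸1≤b : 2 ^ v ∸ 1 ≤ b
  2ᵛ∸1≤b = ∸-monoˡ-≤ 1 (subst (2 ^ v ≤_) (sym β≡2ᵛβ₁) (m≤m*n (2 ^ v) β₁ {{odd⇒nonZero (¬2∣⇒odd 2∤β₁)}}))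
  p^[2ᵛ∸1]≤σ₂ᵛ : p ^ (2 ^ v ∸ 1) ≤ geo (2 ^ k) (suc v)
  p^[2ᵛ∸1]≤σ₂ᵛ = ≤-trans (^-monoʳ-≤ p 2ᵛ∸1≤b) (≤-trans (∣⇒≤ (proj₂ parts)) (geo-mono (2 ^ k) (s≤s a≤v)))
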